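{- Let $(\beta,\lessdot)=(E,\#,\mapsto,l,\lessdot)$ be a prioritized Bundle Event Structure and let $\lessdot'=\lessdot\setminus\{(e,e'),(e',e)\mid e\# e'\vee(\exists X\subseteq E.\ e\in X\wedge X\mapsto e')\}$. Then $\mathrm{Traces}(\beta,\lessdot)=\mathrm{Traces}(\beta,\lessdot')$.
   Context: A Bundle Event Structure (BES) is a quadruple $\beta=(E,\#,\mapsto,l)$ where $E$ is a set of events, $\#\subseteq E\times E$ is an irreflexive symmetric relation (conflict), $\mapsto\subseteq\mathcal{P}(E)\times E$ is the enabling relation (a pair $(X,e)$ is written $X\mapsto e$), and $l:E\to Act$ is a labeling function, satisfying Stability: whenever $X\mapsto e$, any two distinct $e_1,e_2\in X$ satisfy $e_1\# e_2$. For a finite sequence $\sigma=e_1\cdots e_n$ of events write $\bar\sigma=\{e_1,\dots,e_n\}$ and $\sigma_i=e_1\cdots e_i$ ($\sigma_0$ empty). Define $\mathrm{en}_\beta(\sigma)=\{e\in E\setminus\bar\sigma\mid (\forall X\subseteq E.\ X\mapsto e\Rightarrow X\cap\bar\sigma\neq\emptyset)\wedge\neg\exists e'\in\bar\sigma.\ e\# e'\}$. $\sigma$ is a trace of $\beta$ iff $e_i\in\mathrm{en}_\beta(\sigma_{i-1})$ for all $1\le i\le n$. A prioritized BES (PBES) $(\beta,\lessdot)$, also written $(E,\#,\mapsto,l,\lessdot)$, is a BES together with an acyclic relation $\lessdot\subseteq E\times E$ ($e\lessdot e'$: $e'$ has higher priority). $\sigma=e_1\cdots e_n$ is a trace of $(\beta,\lessdot)$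 iff $\sigma$ is a trace of $\beta$ and for all $0\le i<n$ and all $e_j,e_h\in\bar\sigma$ with $e_j\neq e_h$, $e_j,e_h\in\mathrm{en}_\beta(\sigma_i)$ and $e_h\lessdot e_j$, we have $j<h$; $\mathrm{Traces}(\beta,\lessdot)$ is the set of these traces (same definition for any subrelation of $\lessdot$). -}

module Defs where

import Level
open import Level using (Level; 0ℓ)
open import Data.Nat using (ℕ; _<_)
open import Data.Fin using (Fin; toℕ)
open import Data.List using (List; length; lookup; take)
open import Data.List.Membership.Propositional using (_∈_)
open import Data.Product using (Σ; ∃; _×_)
open import Data.Sum using (_⊎_)
open import Relation.Nullary using (¬_)
open import Relation.Binary.PropositionalEquality using (_≡_; _≢_)
open import Relation.Unary using (Pred)
open import Relation.Binary.Construct.Closure.Transitive using (TransClosure)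

record BES (E : Set) (Act : Set) : Set₁ where
  field
    _#_   : E → E → Set
    _↦_   : Pred E 0ℓ → E → Set
    l     : E → Act
    #-irrefl : ∀ e → ¬ (e # e)
    #-sym    : ∀ {e e′} → e # e′ → e′ # e
    stability : ∀ {X e e₁ e₂} → X ↦ e → X e₁ → X e₂ → e₁ ≢ e₂ → e₁ # e₂

module _ {E Act : Set} (β : BES E Act) where
  open BES β

  en : List E → E → Set₁
  en σ e = ¬ (e ∈ σ)
         × (∀ (X : Pred E 0ℓ) → X ↦ e → ∃ λ x → X x × x ∈ σ)
         × ¬ (∃ λ e′ → e′ ∈ σ × e # e′)

  -- σ = e₁⋯eₙ is a trace of β : eᵢ ∈ en(σ_{i-1}) for all i (0-based index k ↦ i = k+1)
  IsTrace : List E → Set₁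
  IsTrace σ = ∀ (k : Fin (length σ)) → en (take (toℕ k) σ) (lookup σ k)

  -- trace of the prioritized BES (β , ⋖)   (e ⋖ e′ : e′ has higher priority)
  IsPTrace : ∀ {ℓ} → (E → E → Set ℓ) → List E → Set (Level.suc 0ℓ Level.⊔ ℓ)
  IsPTrace _⋖_ σ =
    IsTrace σ ×
    (∀ (i : ℕ) → i < length σ →
     ∀ (j h : Fin (length σ)) →
       lookup σ j ≢ lookup σ h →
       en (take i σ) (lookup σ j) →
       en (take i σ) (lookup σ h) →
       lookup σ h ⋖ lookup σ j →
       toℕ j < toℕ h)

  Linked : E → E → Set₁
  Linked e e′ = (e # e′) ⊎ (∃ λ (X : Pred E 0ℓ) → X e × X ↦ e′)

  reduce : (E → E → Set) → (E → E → Set₁)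
  reduce _⋖_ a b = (a ⋖ b) × ¬ (Linked a b) × ¬ (Linked b a)

Acyclic : {E : Set} → (E → E → Set) → Set
Acyclic _⋖_ = ∀ e → ¬ TransClosure _⋖_ e e

-- Priorities only matter between two distinct events that are enabled at the same
-- time. Two events enabled together are never linked: they are not in conflict (in a
-- trace every event avoids conflict with the earlier ones), and if X ∋ a with X ↦ b,
-- then b enabled means some x ∈ X has already occurred, so a is either that x (not
-- enabled, since it occurred) or in conflict with it by stability (not enabled either).
-- Hence removing linked pairs from ⋖ does not change the priority condition.
module Submission where

open import Defs
open import Level using (0ℓ)
open import Data.Empty using (⊥)
open import Data.Fin using (Fin; toℕ; zero; suc)
open import Data.Fin.Properties using (toℕ-injective)
open import Data.List using (List; _∷_; length; lookup; take)
open import Data.List.Membership.Propositional using (_∈_)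
open import Data.List.Relation.Unary.Any using (here; there)
open import Data.Nat using (ℕ; suc; _<_; s≤s)
open import Data.Nat.Properties using (<-cmp)
open import Data.Product using (_,_)
open import Data.Sum using (inj₁; inj₂)
open import Function.Base using (_∘_)
open import Function.Bundles using (_⇔_; mk⇔)
open import Relation.Binary using (tri<; tri≈; tri>)
open import Relation.Binary.PropositionalEquality using (_≢_; refl; sym; cong; subst)
open import Relation.Nullary using (¬_)
open import Relation.Unary using (Pred)

lookup∈take : ∀ {A : Set} (xs : List A) (i : Fin (length xs)) {n : ℕ} →
              toℕ i < n → lookup xs i ∈ take n xs
lookup∈take (x ∷ xs) zero    {suc n} _       = here refl
lookup∈take (x ∷ xs) (suc i) {suc n} (s≤s p) = there (lookup∈take xs i p)

module _ {E Act : Set} (β : BES E Act) where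
  open BES β

  trace-conflict-free : ∀ {σ} → IsTrace β σ → ∀ (j h : Fin (length σ)) →
                        lookup σ j ≢ lookup σ h → ¬ (lookup σ j # lookup σ h)
  trace-conflict-free {σ} tr j h j≢h j#h with <-cmp (toℕ j) (toℕ h)
  ... | tri< j<h _ _ = let (_ , _ , h-free) = tr h in
                       h-free (lookup σ j , lookup∈take σ j j<h , #-sym j#h)
  ... | tri≈ _ j≡h _ = j≢h (cong (lookup σ) (toℕ-injective j≡h))
  ... | tri> _ _ h<j = let (_ , _ , j-free) = tr j in
                       j-free (lookup σ h , lookup∈take σ h h<j , j#h)

  enabled-not-bundled : ∀ {τ a b} {X : Pred E 0ℓ} → X a → X ↦ b →
                        en β τ a → en β τ b → ⊥
  enabled-not-bundled {τ} {X = X} Xa X↦b (a∉τ , _ , a-free) (_ , b-bundles , _)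
    with b-bundles X X↦b
  ... | x , Xx , x∈τ =
    a-free (x , x∈τ , stability X↦b Xa Xx (λ a≡x → a∉τ (subst (_∈ τ) (sym a≡x) x∈τ)))

  co-enabled-unlinked : ∀ {σ} → IsTrace β σ → ∀ (j h : Fin (length σ)) {τ} →
                        lookup σ j ≢ lookup σ h →
                        en β τ (lookup σ j) → en β τ (lookup σ h) →
                        ¬ Linked β (lookup σ j) (lookup σ h)
  co-enabled-unlinked tr j h j≢h _ _ (inj₁ j#h) = trace-conflict-free tr j h j≢h j#h
  co-enabled-unlinked tr j h j≢h en-j en-h (inj₂ (X , Xj , X↦h)) =
    enabled-not-bundled Xj X↦h en-j en-h

theorem3 : {E Act : Set} (β : BES E Act) (_⋖_ : E → E → Set) →
    Acyclic _⋖_ →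
    ∀ (σ : List E) → IsPTrace β _⋖_ σ ⇔ IsPTrace β (reduce β _⋖_) σ
theorem3 β _⋖_ _ σ = mk⇔ restrict extend
  where
  restrict : IsPTrace β _⋖_ σ → IsPTrace β (reduce β _⋖_) σ
  restrict (tr , prio) = tr , λ i i<n j h j≢h en-j en-h (h⋖j , _) →
    prio i i<n j h j≢h en-j en-h h⋖j

  extend : IsPTrace β (reduce β _⋖_) σ → IsPTrace β _⋖_ σ
  extend (tr , prio) = tr , λ i i<n j h j≢h en-j en-h h⋖j →
    prio i i<n j h j≢h en-j en-h
      ( h⋖j
      , co-enabled-unlinked β tr h j (j≢h ∘ sym) en-h en-j
      , co-enabled-unlinked β tr j h j≢h en-j en-h )
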